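{- Let $n\ge1$ and let $(S_1,S_2,S_3,S_4,M)$ be a side-midpoint tuple of subsets of $[n]$. Set $A_i=M\cup S_{i-1}\cup S_i$ for $1\le i\le 4$ (indices mod 4, so $S_0=S_4$). Then: (C1) $A_i\ne A_j$ for all $i\ne j$; (C2) $A_i\ne\emptyset$ for all $1\le i\le4$; (C3) $A_i\cap A_j\ne\emptyset$ for all $i\ne j$; (C4) $\chi_{A_1}+\chi_{A_3}=\chi_{A_2}+\chi_{A_4}$.
   Context: A side-midpoint tuple of subsets of $[n]$ is a tuple $(S_1,S_2,S_3,S_4,M)$ of subsets of $[n]$ such that (S1) $S_i\cap S_j=\emptyset$ for all $i\ne j$; (S2) $M\cap S_i=\emptyset$ for all $i$; (S3) $M\ne\emptyset$; (S4) not both $S_1,S_3$ are empty and not both $S_2,S_4$ are empty. $\chi_A$ denotes the characteristic vector of $A\subseteq[n]$ in $\{0,1\}^n$. -}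

module Defs where

open import Data.Nat using (ℕ; zero; suc)
open import Data.Fin using (Fin; zero; suc)
open import Data.Fin.Subset using (Subset; _∩_; _∪_; ⊥; inside; outside)
open import Data.Vec using (Vec; map; zipWith)
open import Data.Product using (_×_)
open import Relation.Binary.PropositionalEquality using (_≡_; _≢_)
open import Relation.Nullary using (¬_)
import Data.Nat as ℕ

-- Sides indexed by Fin 4: zero ↦ S₁, 1 ↦ S₂, 2 ↦ S₃, 3 ↦ S₄.
-- A side-midpoint tuple (S₁,S₂,S₃,S₄,M) of subsets of [n] (conditions S1–S4).
record SideMidpointTuple (n : ℕ) : Set where
  field
    S : Fin 4 → Subset n
    M : Subset n
    disjoint : ∀ i j → i ≢ j → S i ∩ S j ≡ ⊥
    midDisjoint : ∀ i → M ∩ S i ≡ ⊥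
    midNonempty : M ≢ ⊥
    odd-not-both-empty : ¬ (S zero ≡ ⊥ × S (suc (suc zero)) ≡ ⊥)
    even-not-both-empty : ¬ (S (suc zero) ≡ ⊥ × S (suc (suc (suc zero))) ≡ ⊥)

pred4 : Fin 4 → Fin 4
pred4 zero = suc (suc (suc zero))
pred4 (suc i) = Data.Fin.inject₁ i

A : ∀ {n} → SideMidpointTuple n → Fin 4 → Subset n
A T i = M ∪ S (pred4 i) ∪ S i
  where open SideMidpointTuple T

χ : ∀ {n} → Subset n → Vec ℕ n
χ = map (λ { inside → 1 ; outside → 0 })

_⊕_ : ∀ {n} → Vec ℕ n → Vec ℕ n → Vec ℕ n
_⊕_ = zipWith ℕ._+_

module Submission where

-- By (S1) and (S2) every coordinate k ∈ [n] lies in at most one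
-- of the five sets M, S₁, …, S₄, so it falls into one of six regions: the
-- midpoint M, one of the four sides S_l, or none of them.  Membership of k
-- in each A_i depends only on its region: a midpoint coordinate lies in all
-- four A_i, a coordinate of S_l lies exactly in A_l and A_{l+1}, and any other
-- coordinate lies in no A_i.
-- Then (C2) and (C3) hold because a point of the nonempty M lies in every
-- A_i; (C1) holds because for i ≠ j one of the opposite side pairs {S₁,S₃},
-- {S₂,S₄} separates A_i from A_j and by (S4) that pair has an element; and
-- (C4) holds coordinatewise, region by region.

open import Defs
open import Data.Nat using (ℕ; _≥_; _+_)
open import Data.Bool using (Bool; true; false; _∧_; _∨_) renaming (_≟_ to _≟ᵇ_)
open import Data.Bool.Properties using (¬-not)
open import Data.Fin using (Fin; zero; suc; _≟_)
open import Data.Fin.Properties using (any?)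
open import Data.Fin.Subset using (Subset; _∩_; _∪_; ⊥; inside; outside; Nonempty; _∈_)
open import Data.Fin.Subset.Properties using (nonempty?; Empty-unique; ∉⊥; x∈p∩q⁺; x∈p∪q⁺)
open import Data.Product using (Σ; ∃; _×_; _,_; proj₁; proj₂)
open import Data.Sum using (_⊎_; inj₁; inj₂; [_,_])
open import Data.Vec using (Vec; _∷_; lookup)
open import Data.Vec.Properties using (lookup-zipWith; lookup-replicate; []=⇒lookup; tabulate∘lookup; tabulate-cong)
open import Relation.Nullary using (¬_; yes; no; does; contradiction)
open import Relation.Binary.PropositionalEquality using (_≡_; _≢_; refl; sym; trans; cong; subst; module ≡-Reasoning)
open ≡-Reasoning

vec-ext : ∀ {a} {X : Set a} {n} (u v : Vec X n) → (∀ k → lookup u k ≡ lookup v k) → u ≡ v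
vec-ext u v same = trans (sym (tabulate∘lookup u)) (trans (tabulate-cong same) (tabulate∘lookup v))

nonempty⇒≢⊥ : ∀ {n} {p : Subset n} → Nonempty p → p ≢ ⊥
nonempty⇒≢⊥ (x , x∈p) refl = ∉⊥ x∈p

≢⊥⇒nonempty : ∀ {n} (p : Subset n) → p ≢ ⊥ → Nonempty p
≢⊥⇒nonempty p p≢⊥ with nonempty? p
... | yes ne  = ne
... | no ¬ne = contradiction (Empty-unique ¬ne) p≢⊥

¬both-empty⇒nonempty : ∀ {n} (p q : Subset n) → ¬ (p ≡ ⊥ × q ≡ ⊥) → Nonempty p ⊎ Nonempty q
¬both-empty⇒nonempty p q ¬both with nonempty? p | nonempty? q
... | yes ne-p | _        = inj₁ ne-p
... | no _     | yes ne-q = inj₂ ne-q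
... | no ¬ne-p | no ¬ne-q = contradiction (Empty-unique ¬ne-p , Empty-unique ¬ne-q) ¬both

disjoint-at : ∀ {n} (p q : Subset n) → p ∩ q ≡ ⊥ → ∀ k → lookup p k ∧ lookup q k ≡ false
disjoint-at p q p∩q≡⊥ k = begin
  lookup p k ∧ lookup q k  ≡⟨ sym (lookup-zipWith _∧_ k p q) ⟩
  lookup (p ∩ q) k         ≡⟨ cong (λ v → lookup v k) p∩q≡⊥ ⟩
  lookup ⊥ k               ≡⟨ lookup-replicate k outside ⟩
  false                    ∎

at-most-one : ∀ {m} (b : Fin m → Bool) → (∀ i j → i ≢ j → b i ∧ b j ≡ false) →
              (∀ i → b i ≡ false) ⊎ (∃ λ l → ∀ i → b i ≡ does (l ≟ i))
at-most-one b disjoint with any? (λ i → b i ≟ᵇ true)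
... | no no-true = inj₁ (λ i → ¬-not (λ bi → no-true (i , bi)))
... | yes (l , bl≡true) = inj₂ (l , indicator)
  where
  indicator : ∀ i → b i ≡ does (l ≟ i)
  indicator i with l ≟ i
  ... | yes refl = bl≡true
  ... | no l≢i   = subst (λ x → x ∧ b i ≡ false) bl≡true (disjoint l i l≢i)

bit : Bool → ℕ
bit true  = 1
bit false = 0

χ-lookup : ∀ {n} (X : Subset n) k → lookup (χ X) k ≡ bit (lookup X k)
χ-lookup (inside  ∷ X) zero    = refl
χ-lookup (outside ∷ X) zero    = refl
χ-lookup (_       ∷ X) (suc k) = χ-lookup X k

data Region : Set where
  mid  : Region
  side : Fin 4 → Region
  none : Region

inM : Region → Bool
inM mid = true
inM _   = false

inS : Region → Fin 4 → Bool
inS (side l) i = does (l ≟ i)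
inS _        _ = false

inA : Region → Fin 4 → Bool
inA r i = inM r ∨ (inS r (pred4 i) ∨ inS r i)

balanced : ∀ r → bit (inA r zero) + bit (inA r (suc (suc zero)))
               ≡ bit (inA r (suc zero)) + bit (inA r (suc (suc (suc zero))))
balanced mid                             = refl
balanced none                            = refl
balanced (side zero)                     = refl
balanced (side (suc zero))               = refl
balanced (side (suc (suc zero)))         = refl
balanced (side (suc (suc (suc zero))))   = refl

Separates : Fin 4 → Fin 4 → Fin 4 → Set
Separates l i j = inA (side l) i ≢ inA (side l) j

opposite-sides-separate : ∀ i j → i ≢ j →
  (Separates zero i j × Separates (suc (suc zero)) i j)
  ⊎ (Separates (suc zero) i j × Separates (suc (suc (suc zero))) i j)
opposite-sides-separate zero                   zero                   i≢j = contradiction refl i≢j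
opposite-sides-separate (suc zero)             (suc zero)             i≢j = contradiction refl i≢j
opposite-sides-separate (suc (suc zero))       (suc (suc zero))       i≢j = contradiction refl i≢j
opposite-sides-separate (suc (suc (suc zero))) (suc (suc (suc zero))) i≢j = contradiction refl i≢j
opposite-sides-separate zero                   (suc zero)             _ = inj₂ ((λ ()) , (λ ()))
opposite-sides-separate zero                   (suc (suc zero))       _ = inj₁ ((λ ()) , (λ ()))
opposite-sides-separate zero                   (suc (suc (suc zero))) _ = inj₁ ((λ ()) , (λ ()))
opposite-sides-separate (suc zero)             zero                   _ = inj₂ ((λ ()) , (λ ()))
opposite-sides-separate (suc zero)             (suc (suc zero))       _ = inj₁ ((λ ()) , (λ ()))
opposite-sides-separate (suc zero)             (suc (suc (suc zero))) _ = inj₂ ((λ ()) , (λ ()))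
opposite-sides-separate (suc (suc zero))       zero                   _ = inj₁ ((λ ()) , (λ ()))
opposite-sides-separate (suc (suc zero))       (suc zero)             _ = inj₁ ((λ ()) , (λ ()))
opposite-sides-separate (suc (suc zero))       (suc (suc (suc zero))) _ = inj₂ ((λ ()) , (λ ()))
opposite-sides-separate (suc (suc (suc zero))) zero                   _ = inj₁ ((λ ()) , (λ ()))
opposite-sides-separate (suc (suc (suc zero))) (suc zero)             _ = inj₂ ((λ ()) , (λ ()))
opposite-sides-separate (suc (suc (suc zero))) (suc (suc zero))       _ = inj₂ ((λ ()) , (λ ()))

inS-true⇒side : ∀ r l → inS r l ≡ true → r ≡ side l
inS-true⇒side mid      l ()
inS-true⇒side none     l ()
inS-true⇒side (side l′) l eq with l′ ≟ l
inS-true⇒side (side l′) l refl | yes refl = refl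
inS-true⇒side (side l′) l ()   | no _

module Regions {n : ℕ} (T : SideMidpointTuple n) where
  open SideMidpointTuple T

  HasPattern : Fin n → Region → Set
  HasPattern k r = lookup M k ≡ inM r × (∀ i → lookup (S i) k ≡ inS r i)

  -- (S1) and (S2) put every coordinate in exactly one region.
  classify : ∀ k → Σ Region (HasPattern k)
  classify k with lookup M k in M-at-k
  ... | true  = mid , refl , λ i → subst (λ x → x ∧ lookup (S i) k ≡ false) M-at-k
                                      (disjoint-at M (S i) (midDisjoint i) k)
  ... | false with at-most-one (λ i → lookup (S i) k)
                               (λ i j i≢j → disjoint-at (S i) (S j) (disjoint i j i≢j) k)
  ...   | inj₁ all-false       = none , refl , all-false
  ...   | inj₂ (l , indicator) = side l , refl , indicator

  region : Fin n → Region
  region k = proj₁ (classify k)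

  A-lookup : ∀ i k → lookup (A T i) k ≡ inA (region k) i
  A-lookup i k with classify k
  ... | r , M-at-k , S-at-k = begin
    lookup (M ∪ S (pred4 i) ∪ S i) k
      ≡⟨ lookup-zipWith _∨_ k M (S (pred4 i) ∪ S i) ⟩
    lookup M k ∨ lookup (S (pred4 i) ∪ S i) k
      ≡⟨ cong (lookup M k ∨_) (lookup-zipWith _∨_ k (S (pred4 i)) (S i)) ⟩
    lookup M k ∨ (lookup (S (pred4 i)) k ∨ lookup (S i) k)
      ≡⟨ cong (λ x → x ∨ (lookup (S (pred4 i)) k ∨ lookup (S i) k)) M-at-k ⟩
    inM r ∨ (lookup (S (pred4 i)) k ∨ lookup (S i) k)
      ≡⟨ cong (λ x → inM r ∨ (x ∨ lookup (S i) k)) (S-at-k (pred4 i)) ⟩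
    inM r ∨ (inS r (pred4 i) ∨ lookup (S i) k)
      ≡⟨ cong (λ x → inM r ∨ (inS r (pred4 i) ∨ x)) (S-at-k i) ⟩
    inA r i ∎

  Occupied : Fin 4 → Set
  Occupied l = ∃ λ k → region k ≡ side l

  occupied : ∀ l → Nonempty (S l) → Occupied l
  occupied l (k , k∈Sl) =
    k , inS-true⇒side (region k) l (trans (sym (proj₂ (proj₂ (classify k)) l)) ([]=⇒lookup k∈Sl))

  occupied-of-pair : ∀ l l′ → ¬ (S l ≡ ⊥ × S l′ ≡ ⊥) → Occupied l ⊎ Occupied l′
  occupied-of-pair l l′ ¬both with ¬both-empty⇒nonempty (S l) (S l′) ¬both
  ... | inj₁ ne = inj₁ (occupied l ne)
  ... | inj₂ ne = inj₂ (occupied l′ ne)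

  separated⇒distinct : ∀ i j l → Occupied l → Separates l i j → A T i ≢ A T j
  separated⇒distinct i j l (k , region≡side) separates Ai≡Aj = separates (begin
    inA (side l) i      ≡⟨ cong (λ r → inA r i) (sym region≡side) ⟩
    inA (region k) i    ≡⟨ sym (A-lookup i k) ⟩
    lookup (A T i) k    ≡⟨ cong (λ X → lookup X k) Ai≡Aj ⟩
    lookup (A T j) k    ≡⟨ A-lookup j k ⟩
    inA (region k) j    ≡⟨ cong (λ r → inA r j) region≡side ⟩
    inA (side l) j      ∎)

  pair-separated⇒distinct : ∀ i j l l′ → ¬ (S l ≡ ⊥ × S l′ ≡ ⊥) →
                            Separates l i j → Separates l′ i j → A T i ≢ A T j
  pair-separated⇒distinct i j l l′ ¬both sep sep′ =
    [ (λ occ → separated⇒distinct i j l occ sep) , (λ occ → separated⇒distinct i j l′ occ sep′) ]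
      (occupied-of-pair l l′ ¬both)

  M⊆A : ∀ i {x} → x ∈ M → x ∈ A T i
  M⊆A i x∈M = x∈p∪q⁺ (inj₁ x∈M)

  pair-count : ∀ i j k → lookup (χ (A T i) ⊕ χ (A T j)) k ≡ bit (inA (region k) i) + bit (inA (region k) j)
  pair-count i j k = begin
    lookup (χ (A T i) ⊕ χ (A T j)) k                    ≡⟨ lookup-zipWith _+_ k (χ (A T i)) (χ (A T j)) ⟩
    lookup (χ (A T i)) k + lookup (χ (A T j)) k          ≡⟨ cong (_+ lookup (χ (A T j)) k) (χ-lookup (A T i) k) ⟩
    bit (lookup (A T i) k) + lookup (χ (A T j)) k        ≡⟨ cong (bit (lookup (A T i) k) +_) (χ-lookup (A T j) k) ⟩
    bit (lookup (A T i) k) + bit (lookup (A T j) k)      ≡⟨ cong (_+ bit (lookup (A T j) k)) (cong bit (A-lookup i k)) ⟩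
    bit (inA (region k) i) + bit (lookup (A T j) k)      ≡⟨ cong (bit (inA (region k) i) +_) (cong bit (A-lookup j k)) ⟩
    bit (inA (region k) i) + bit (inA (region k) j)      ∎

proposition7p8 : (n : ℕ) → n ≥ 1 → (T : SideMidpointTuple n) →
    (∀ i j → i ≢ j → A T i ≢ A T j)
    × (∀ i → A T i ≢ ⊥)
    × (∀ i j → i ≢ j → A T i ∩ A T j ≢ ⊥)
    × (χ (A T zero) ⊕ χ (A T (suc (suc zero))) ≡ χ (A T (suc zero)) ⊕ χ (A T (suc (suc (suc zero)))))
proposition7p8 n _ T = C1 , C2 , C3 , C4
  where
  open SideMidpointTuple T
  open Regions T

  M-point : Nonempty M
  M-point = ≢⊥⇒nonempty M midNonempty

  C1 : ∀ i j → i ≢ j → A T i ≢ A T j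
  C1 i j i≢j with opposite-sides-separate i j i≢j
  ... | inj₁ (sep₁ , sep₃) = pair-separated⇒distinct i j _ _ odd-not-both-empty sep₁ sep₃
  ... | inj₂ (sep₂ , sep₄) = pair-separated⇒distinct i j _ _ even-not-both-empty sep₂ sep₄

  C2 : ∀ i → A T i ≢ ⊥
  C2 i = nonempty⇒≢⊥ (_ , M⊆A i (proj₂ M-point))

  C3 : ∀ i j → i ≢ j → A T i ∩ A T j ≢ ⊥
  C3 i j _ = nonempty⇒≢⊥ (_ , x∈p∩q⁺ (M⊆A i (proj₂ M-point) , M⊆A j (proj₂ M-point)))

  C4 : χ (A T zero) ⊕ χ (A T (suc (suc zero))) ≡ χ (A T (suc zero)) ⊕ χ (A T (suc (suc (suc zero))))
  C4 = vec-ext _ _ λ k →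
    trans (pair-count _ _ k) (trans (balanced (region k)) (sym (pair-count _ _ k)))
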